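{- Let $p$ be a prime and $H$ a square-free graph in which every vertex $\gamma$ satisfies $\deg(\gamma)\equiv1\pmod p$. Let $C=\theta\gamma_1\gamma_2\cdots\gamma_k\theta$, $k\ge2$, be a cycle in $H$, and let $\mathcal K=(K,\tau)$ be the partial $H$-labelled graph with $V(K)=\{s,t\}\cup\{v_i,u_i:1\le i\le k\}$, $E(K)=\{v_iv_{i+1}:1\le i\le k-1\}\cup\{v_iu_i:1\le i\le k\}\cup\{sv_1,v_kt\}$ and pinning $\tau(u_i)=\gamma_i$. Let $\Delta_1=\Delta_2=\{\gamma_1,\gamma_k\}$, $\delta_1=\gamma_1$, $\delta_2=\gamma_k$. Then for any $\omega_s\in\Delta_1\setminus\{\delta_1\}$ and $\omega_t\in\Delta_2\setminus\{\delta_2\}$: (1) $|\mathsf{Hom}((\mathcal K,s,t),(H,\omega_s,\omega_t))|=0$; (2) $|\mathsf{Hom}((\mathcal K,s,t),(H,\delta_1,\omega_t))|\equiv1\pmod p$; (3) $|\mathsf{Hom}((\mathcal K,s,t),(H,\omega_s,\delta_2))|\equiv1\pmod p$; (4) $|\mathsf{Hom}((\mathcal K,s,t),(H,\delta_1,\delta_2))|\equiv1\pmod p$.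
   Context: Graphs are finite, undirected, loopless, without parallel edges; square-free means no cycle of length 4; $\deg(v)$ is the degree of $v$. A partial $H$-labelled graph is a graph with a partial pinning function to $V(H)$; $\mathsf{Hom}((\mathcal G,x_1,x_2),(H,y_1,y_2))$ is the set of graph homomorphisms $\mathcal G\to H$ extending the pinning and mapping $x_i$ to $y_i$. -}

module Defs where

open import Data.Nat using (ℕ; zero; suc; _+_)
open import Data.Bool using (Bool; true; false; _∨_; _∧_; not)
open import Data.Fin using (Fin; zero; suc; toℕ; splitAt; _↑ˡ_; _↑ʳ_)
open import Data.Fin.Properties using () renaming (_≟_ to _≟F_)
open import Data.Nat.Properties using () renaming (_≟_ to _≟N_)
open import Data.List using (List; []; _∷_; map; concatMap; length; filterᵇ; allFin)
open import Data.Bool.ListAction using (and)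
open import Data.Maybe using (Maybe; just; nothing)
open import Data.Sum using (inj₁; inj₂)
open import Data.Product using (_×_; _,_)
open import Relation.Nullary.Decidable using (⌊_⌋)
open import Relation.Binary.PropositionalEquality using (_≡_; _≢_; refl)
open import Data.Bool.Properties using (∨-comm)
open import Relation.Nullary.Decidable using (no; yes)
open import Data.Nat.Properties using (1+n≢n)
open import Data.Empty using (⊥-elim)
import Data.Vec.Functional as VF

record Graph : Set where
  field
    n      : ℕ
    adj    : Fin n → Fin n → Bool
    sym    : ∀ x y → adj x y ≡ adj y x
    irrefl : ∀ x → adj x x ≡ false
open Graph public

deg : (G : Graph) → Fin (n G) → ℕ
deg G x = length (filterᵇ (adj G x) (allFin (n G)))

SquareFree : Graph → Set
SquareFree G = ∀ a b c d →
  a ≢ b → a ≢ c → a ≢ d → b ≢ c → b ≢ d → c ≢ d →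
  adj G a b ≡ true → adj G b c ≡ true → adj G c d ≡ true → adj G d a ≡ true →
  Data.Empty.⊥
  where import Data.Empty

allᵇ : {A : Set} → (A → Bool) → List A → Bool
allᵇ p xs = and (map p xs)

allFuns : (m k : ℕ) → List (Fin m → Fin k)
allFuns zero    k = VF.[] ∷ []
allFuns (suc m) k = concatMap (λ a → map (λ f → a VF.∷ f) (allFuns m k)) (allFin k)

isHomᵇ : (G H : Graph) → (Fin (n G) → Fin (n H)) → Bool
isHomᵇ G H f = allᵇ (λ a → allᵇ (λ b → not (adj G a b) ∨ adj H (f a) (f b)) (allFin (n G))) (allFin (n G))

respectsᵇ : (G H : Graph) → (Fin (n G) → Maybe (Fin (n H))) → (Fin (n G) → Fin (n H)) → Bool
respectsᵇ G H τ f = allᵇ ok (allFin (n G))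
  where
  ok : Fin (n G) → Bool
  ok a with τ a
  ... | nothing = true
  ... | just y  = ⌊ f a ≟F y ⌋

homCount : (G H : Graph) → (τ : Fin (n G) → Maybe (Fin (n H))) →
           (x₁ x₂ : Fin (n G)) → (y₁ y₂ : Fin (n H)) → ℕ
homCount G H τ x₁ x₂ y₁ y₂ = length (filterᵇ good (allFuns (n G) (n H)))
  where
  good : (Fin (n G) → Fin (n H)) → Bool
  good f = isHomᵇ G H f ∧ respectsᵇ G H τ f ∧ ⌊ f x₁ ≟F y₁ ⌋ ∧ ⌊ f x₂ ≟F y₂ ⌋

-- Vertices: s, t, v₁..v_k, u₁..u_k,
-- encoded in Fin (2 + (k + k)) as s = 0, t = 1, vᵢ = 2 + (i-1), uᵢ = 2 + k + (i-1).
-- Indices i below are 0-based (Fin k), i.e. Fin index i stands for paper's i+1.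

data KV (k : ℕ) : Set where
  s t : KV k
  v u : Fin k → KV k

kdecode : (k : ℕ) → Fin (2 + (k + k)) → KV k
kdecode k zero = s
kdecode k (suc zero) = t
kdecode k (suc (suc x)) with splitAt k x
... | inj₁ i = v i
... | inj₂ i = u i

sK tK : (k : ℕ) → Fin (2 + (k + k))
sK k = zero
tK k = suc zero

vK uK : (k : ℕ) → Fin k → Fin (2 + (k + k))
vK k i = suc (suc (i ↑ˡ k))
uK k i = suc (suc (k ↑ʳ i))

kEdge₀ : (k : ℕ) → KV k → KV k → Bool
kEdge₀ k (v i) (v j) = ⌊ suc (toℕ i) ≟N toℕ j ⌋
kEdge₀ k (v i) (u j) = ⌊ i ≟F j ⌋
kEdge₀ k s     (v j) = ⌊ toℕ j ≟N 0 ⌋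
kEdge₀ k (v i) t     = ⌊ suc (toℕ i) ≟N k ⌋
kEdge₀ k _     _     = false

kAdj : (k : ℕ) → Fin (2 + (k + k)) → Fin (2 + (k + k)) → Bool
kAdj k a b = kEdge₀ k (kdecode k a) (kdecode k b) ∨ kEdge₀ k (kdecode k b) (kdecode k a)

kEdge₀-irr : (k : ℕ) → (x : KV k) → kEdge₀ k x x ≡ false
kEdge₀-irr k s = refl
kEdge₀-irr k t = refl
kEdge₀-irr k (u i) = refl
kEdge₀-irr k (v i) with suc (toℕ i) ≟N toℕ i
... | yes e = ⊥-elim (1+n≢n e)
... | no _ = refl

K : (k : ℕ) → Graph
K k = record
  { n = 2 + (k + k)
  ; adj = kAdj k
  ; sym = λ a b → ∨-comm (kEdge₀ k (kdecode k a) (kdecode k b)) (kEdge₀ k (kdecode k b) (kdecode k a))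
  ; irrefl = λ a → Relation.Binary.PropositionalEquality.cong (λ z → z ∨ z) (kEdge₀-irr k (kdecode k a))
  }

kPin : (k : ℕ) (H : Graph) → (Fin k → Fin (n H)) → Fin (2 + (k + k)) → Maybe (Fin (n H))
kPin k H γ a with kdecode k a
... | u i = just (γ i)
... | _   = nothing

-- C = θ γ₁ … γ_k θ is a cycle in H (γ given 0-based as Fin k → V(H))
IsCycle : (H : Graph) (k : ℕ) → Fin (n H) → (Fin k → Fin (n H)) → Set
IsCycle H k θ γ =
  (∀ i j → γ i ≡ γ j → i ≡ j) ×
  (∀ i → θ ≢ γ i) ×
  (∀ i → toℕ i ≡ 0 → adj H θ (γ i) ≡ true) ×
  (∀ i j → suc (toℕ i) ≡ toℕ j → adj H (γ i) (γ j) ≡ true) ×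
  (∀ i → suc (toℕ i) ≡ k → adj H (γ i) θ ≡ true)

-- A homomorphism from K with s ↦ a and t ↦ b is a walk a, w₁, …, w_k, b in H with each wᵢ adjacent to γᵢ,
-- so all four numbers count such walks. In a square-free graph two distinct vertices have at most one
-- common neighbour, so a walk that reaches the cycle one step behind it has to follow it.
-- From γ_k the walk must step to θ, the only common neighbour of γ_k and γ₁, and is then forced along
-- θ, γ₁, …, γ_{k-1}; it ends at ω iff γ_{k-1} ~ ω. This gives (1) and (3), since γ_{k-1} ≁ γ₁
-- (otherwise γ_{k-1} and θ would be two common neighbours of γ_k and γ₁).
-- From γ₁ the walk steps either to γ₂, leaving the same problem for γ₂, …, γ_k, or to one of the other
-- deg γ₁ - 1 ≡ 0 neighbours, each of which forces a walk ending at ω iff γ_{k-1} ~ ω. Dropping the teeth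
-- one at a time therefore does not change the count modulo p (nor at all when ω = γ₁), down to a single
-- tooth at γ_k: then deg γ_k ≡ 1 walks end at γ_k, and exactly one, through θ, ends at γ₁.

module Submission where

open import Defs hiding (sym)
open import Data.Nat using (ℕ; zero; suc; _+_; _*_; _≤_; _%_; NonZero; s≤s)
open import Data.Nat.Properties using (_≟_; +-*-semiring; +-identityʳ; *-identityʳ; *-zeroʳ; +-assoc; +-comm; +-suc; suc-injective)
open import Data.Nat.DivMod using (%-distribˡ-+; [m+n]%n≡m%n)
open import Data.Nat.ListAction using () renaming (sum to sumˡ)
open import Data.Nat.Primality using (Prime)
open import Data.Bool using (Bool; true; false; _∧_; _∨_; not)
open import Data.Bool.Properties using (∧-assoc; ∧-idem; ⇔→≡)
open import Data.Fin using (Fin; zero; suc; toℕ; fromℕ; punchIn; splitAt)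
open import Data.Fin.Properties using (punchInᵢ≢i; toℕ-fromℕ; toℕ-injective; splitAt-↑ˡ; splitAt-↑ʳ; splitAt⁻¹-↑ˡ; splitAt⁻¹-↑ʳ) renaming (suc-injective to suc-injectiveF; _≟_ to _≟F_)
open import Data.List using (List; []; _∷_; _++_; map; concat; length; filterᵇ; allFin; tabulate)
open import Data.List.Properties using (map-∘)
open import Data.Vec.Functional using (Vector; head; tail; init; last; take; drop) renaming (_∷_ to _∷ᵥ_; [] to []ᵥ)
open import Data.Product using (_×_; _,_; proj₁; proj₂)
open import Data.Sum using (_⊎_; inj₁; inj₂; swap)
open import Data.Maybe using (Maybe; just; nothing)
open import Function using (_∘_; _⇔_; mk⇔; Equivalence; Injective)
open import Function.Properties.Equivalence using () renaming (refl to ⇔-refl; sym to ⇔-sym; trans to ⇔-trans)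
open import Data.Product.Function.NonDependent.Propositional using (_×-⇔_)
open import Data.Empty using (⊥; ⊥-elim)
open import Relation.Nullary using (Dec; yes; no; ¬_; contradiction)
open import Relation.Nullary.Decidable using (⌊_⌋)
open import Relation.Binary.PropositionalEquality
open import Algebra.Properties.Semiring.Sum +-*-semiring
  using (sum; sum-syntax; sum-cong-≗; sum-replicate-zero; sum-remove; *-distribʳ-sum)

⌊⌋-true⇔ : {P : Set} (d : Dec P) → ⌊ d ⌋ ≡ true ⇔ P
⌊⌋-true⇔ (yes p) = mk⇔ (λ _ → p) (λ _ → refl)
⌊⌋-true⇔ (no ¬p) = mk⇔ (λ ()) (λ p → contradiction p ¬p)

⌊⌋-false : {P : Set} (d : Dec P) → ¬ P → ⌊ d ⌋ ≡ false
⌊⌋-false (yes p) ¬p = contradiction p ¬p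
⌊⌋-false (no _)  ¬p = refl

∧-≡false : {x y : Bool} → (x ≡ true → y ≡ true → ⊥) → x ∧ y ≡ false
∧-≡false {true}  {true}  h = ⊥-elim (h refl refl)
∧-≡false {true}  {false} h = refl
∧-≡false {false}         h = refl

∧-≡true⇔ : {x y : Bool} → x ∧ y ≡ true ⇔ (x ≡ true × y ≡ true)
∧-≡true⇔ {true}  = mk⇔ (refl ,_) proj₂
∧-≡true⇔ {false} = mk⇔ (λ ()) proj₁

not-∨-≡true⇔ : {x y : Bool} → not x ∨ y ≡ true ⇔ (x ≡ true → y ≡ true)
not-∨-≡true⇔ {true}  = mk⇔ (λ y≡true _ → y≡true) (λ h → h refl)
not-∨-≡true⇔ {false} = mk⇔ (λ _ ()) (λ _ → refl)

≡-other : {A : Set} {x a b : A} → x ≡ a ⊎ x ≡ b → x ≢ a → x ≡ b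
≡-other (inj₁ x≡a) x≢a = contradiction x≡a x≢a
≡-other (inj₂ x≡b) x≢a = x≡b

index-head : {A : Set} {m : ℕ} (γ : Vector A (suc m)) {i : Fin (suc m)} → toℕ i ≡ 0 → γ i ≡ head γ
index-head γ {i} i≡0 = cong γ (toℕ-injective i≡0)

index-last : {A : Set} {m : ℕ} (γ : Vector A (suc m)) {i : Fin (suc m)} → toℕ i ≡ m → γ i ≡ last γ
index-last {m = m} γ i≡m = cong γ (toℕ-injective (trans i≡m (sym (toℕ-fromℕ m))))

allᵇ-tabulate⇔ : {A : Set} {n : ℕ} (p : A → Bool) (g : Fin n → A) → allᵇ p (tabulate g) ≡ true ⇔ (∀ i → p (g i) ≡ true)
allᵇ-tabulate⇔ {n = zero}  p g = mk⇔ (λ _ ()) (λ _ → refl)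
allᵇ-tabulate⇔ {n = suc n} p g = mk⇔ to from
  where
  to : allᵇ p (tabulate g) ≡ true → ∀ i → p (g i) ≡ true
  to all-p zero    = proj₁ (Equivalence.to ∧-≡true⇔ all-p)
  to all-p (suc i) = Equivalence.to (allᵇ-tabulate⇔ p (g ∘ suc)) (proj₂ (Equivalence.to ∧-≡true⇔ all-p)) i
  from : (∀ i → p (g i) ≡ true) → allᵇ p (tabulate g) ≡ true
  from p-g = Equivalence.from ∧-≡true⇔ (p-g zero , Equivalence.from (allᵇ-tabulate⇔ p (g ∘ suc)) (p-g ∘ suc))

-- Counting with Boolean tests

iverson : Bool → ℕ
iverson true  = 1
iverson false = 0

iverson-∧ : (x y : Bool) → iverson x * iverson y ≡ iverson (x ∧ y)
iverson-∧ true  true  = refl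
iverson-∧ true  false = refl
iverson-∧ false y     = refl

count : {A : Set} → (A → Bool) → List A → ℕ
count p xs = length (filterᵇ p xs)

module _ {A : Set} where

  count-∷ : (p : A → Bool) (x : A) (xs : List A) → count p (x ∷ xs) ≡ iverson (p x) + count p xs
  count-∷ p x xs with p x
  ... | true  = refl
  ... | false = refl

  count-++ : (p : A → Bool) (xs ys : List A) → count p (xs ++ ys) ≡ count p xs + count p ys
  count-++ p []       ys = refl
  count-++ p (x ∷ xs) ys = begin
    count p (x ∷ xs ++ ys)                      ≡⟨ count-∷ p x (xs ++ ys) ⟩
    iverson (p x) + count p (xs ++ ys)          ≡⟨ cong (iverson (p x) +_) (count-++ p xs ys) ⟩
    iverson (p x) + (count p xs + count p ys)   ≡⟨ +-assoc (iverson (p x)) _ _ ⟨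
    (iverson (p x) + count p xs) + count p ys   ≡⟨ cong (_+ count p ys) (count-∷ p x xs) ⟨
    count p (x ∷ xs) + count p ys               ∎
    where open ≡-Reasoning

  count-concat : (p : A → Bool) (xss : List (List A)) → count p (concat xss) ≡ sumˡ (map (count p) xss)
  count-concat p []         = refl
  count-concat p (xs ∷ xss) = trans (count-++ p xs (concat xss)) (cong (count p xs +_) (count-concat p xss))

  count-cong : {p q : A → Bool} → p ≗ q → (xs : List A) → count p xs ≡ count q xs
  count-cong p≗q []       = refl
  count-cong {p} {q} p≗q (x ∷ xs) = begin
    count p (x ∷ xs)               ≡⟨ count-∷ p x xs ⟩
    iverson (p x) + count p xs     ≡⟨ cong₂ (λ b m → iverson b + m) (p≗q x) (count-cong p≗q xs) ⟩
    iverson (q x) + count q xs     ≡⟨ count-∷ q x xs ⟨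
    count q (x ∷ xs)               ∎
    where open ≡-Reasoning

  count-const-∧ : (c : Bool) (q : A → Bool) (xs : List A) → count (λ x → c ∧ q x) xs ≡ iverson c * count q xs
  count-const-∧ true  q xs = sym (+-identityʳ (count q xs))
  count-const-∧ false q []       = refl
  count-const-∧ false q (x ∷ xs) = count-const-∧ false q xs

count-map : {A B : Set} (p : B → Bool) (g : A → B) (xs : List A) → count p (map g xs) ≡ count (p ∘ g) xs
count-map p g []       = refl
count-map p g (x ∷ xs) = begin
  count p (g x ∷ map g xs)            ≡⟨ count-∷ p (g x) (map g xs) ⟩
  iverson (p (g x)) + count p (map g xs) ≡⟨ cong (iverson (p (g x)) +_) (count-map p g xs) ⟩
  iverson (p (g x)) + count (p ∘ g) xs  ≡⟨ count-∷ (p ∘ g) x xs ⟨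
  count (p ∘ g) (x ∷ xs)              ∎
  where open ≡-Reasoning

sum-map-tabulate : {A : Set} {n : ℕ} (f : A → ℕ) (g : Fin n → A) → sumˡ (map f (tabulate g)) ≡ ∑[ i < n ] f (g i)
sum-map-tabulate {n = zero}  f g = refl
sum-map-tabulate {n = suc n} f g = cong (f (g zero) +_) (sum-map-tabulate f (g ∘ suc))

count-tabulate : {A : Set} {n : ℕ} (p : A → Bool) (g : Fin n → A) → count p (tabulate g) ≡ ∑[ i < n ] iverson (p (g i))
count-tabulate {n = zero}  p g = refl
count-tabulate {n = suc n} p g = trans (count-∷ p (g zero) (tabulate (g ∘ suc))) (cong (iverson (p (g zero)) +_) (count-tabulate p (g ∘ suc)))

∑-zero : {n : ℕ} (f : Vector ℕ n) → (∀ x → f x ≡ 0) → ∑[ x < n ] f x ≡ 0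
∑-zero {n} f f≡0 = trans (sum-cong-≗ f≡0) (sum-replicate-zero n)

∑-single : {n : ℕ} (f : Vector ℕ n) (c : Fin n) → (∀ x → x ≢ c → f x ≡ 0) → ∑[ x < n ] f x ≡ f c
∑-single {suc n} f c off-c = begin
  sum f                          ≡⟨ sum-remove {i = c} f ⟩
  f c + sum (f ∘ punchIn c)      ≡⟨ cong (f c +_) (∑-zero (f ∘ punchIn c) (λ x → off-c _ (punchInᵢ≢i c x))) ⟩
  f c + 0                        ≡⟨ +-identityʳ (f c) ⟩
  f c                            ∎
  where open ≡-Reasoning

∑-except-one : {n : ℕ} (P : Fin n → Bool) (g : Vector ℕ n) (κ : ℕ) (c : Fin n) → P c ≡ true →
  (∀ x → x ≢ c → P x ≡ true → g x ≡ κ) →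
  ∑[ x < n ] (iverson (P x) * g x) + κ ≡ g c + (∑[ x < n ] iverson (P x)) * κ
∑-except-one {suc n} P g κ c Pc g≡κ = begin
  sum (λ x → iverson (P x) * g x) + κ                      ≡⟨ cong (_+ κ) (sum-remove {i = c} (λ x → iverson (P x) * g x)) ⟩
  iverson (P c) * g c + sum (λ x → iverson (P (punchIn c x)) * g (punchIn c x)) + κ
                                                           ≡⟨ cong₂ (λ b m → iverson b * g c + m + κ) Pc (sum-cong-≗ others) ⟩
  (g c + 0) + rest + κ                                     ≡⟨ cong (λ m → m + rest + κ) (+-identityʳ (g c)) ⟩
  g c + rest + κ                                           ≡⟨ +-assoc (g c) rest κ ⟩
  g c + (rest + κ)                                         ≡⟨ cong (g c +_) (+-comm rest κ) ⟩
  g c + (κ + rest)                                         ≡⟨ cong (λ m → g c + (m + rest)) (+-identityʳ κ) ⟨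
  g c + (iverson true * κ + rest)                          ≡⟨ cong (λ b → g c + (iverson b * κ + rest)) Pc ⟨
  g c + (iverson (P c) * κ + rest)                         ≡⟨ cong (g c +_) (sum-remove {i = c} (λ x → iverson (P x) * κ)) ⟨
  g c + sum (λ x → iverson (P x) * κ)                      ≡⟨ cong (g c +_) (*-distribʳ-sum κ (λ x → iverson (P x))) ⟨
  g c + sum (λ x → iverson (P x)) * κ                      ∎
  where
  open ≡-Reasoning
  rest : ℕ
  rest = sum (λ x → iverson (P (punchIn c x)) * κ)
  others : ∀ x → iverson (P (punchIn c x)) * g (punchIn c x) ≡ iverson (P (punchIn c x)) * κ
  others x with P (punchIn c x) in Px
  ... | false = refl
  ... | true  = cong (_+ 0) (g≡κ (punchIn c x) (punchInᵢ≢i c x) Px)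

-- Counting functions between finite sets

count-allFuns-suc : {m r : ℕ} (P : Vector (Fin r) (suc m) → Bool) →
  count P (allFuns (suc m) r) ≡ ∑[ x < r ] count (λ g → P (x ∷ᵥ g)) (allFuns m r)
count-allFuns-suc {m} {r} P = begin
  count P (concat (map extend (allFin r)))        ≡⟨ count-concat P (map extend (allFin r)) ⟩
  sumˡ (map (count P) (map extend (allFin r)))    ≡⟨ cong sumˡ (map-∘ (allFin r)) ⟨
  sumˡ (map (count P ∘ extend) (allFin r))        ≡⟨ sum-map-tabulate (count P ∘ extend) (λ x → x) ⟩
  ∑[ x < r ] count P (extend x)                   ≡⟨ sum-cong-≗ (λ x → count-map P (x ∷ᵥ_) (allFuns m r)) ⟩
  ∑[ x < r ] count (λ g → P (x ∷ᵥ g)) (allFuns m r) ∎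
  where
  open ≡-Reasoning
  extend : Fin r → List (Vector (Fin r) (suc m))
  extend x = map (x ∷ᵥ_) (allFuns m r)

count-allFuns-pinned-head : {m r : ℕ} (a : Fin r) (P : Vector (Fin r) m → Bool) →
  count (λ g → ⌊ head g ≟F a ⌋ ∧ P (tail g)) (allFuns (suc m) r) ≡ count P (allFuns m r)
count-allFuns-pinned-head {m} {r} a P = begin
  count (λ g → ⌊ head g ≟F a ⌋ ∧ P (tail g)) (allFuns (suc m) r)
    ≡⟨ count-allFuns-suc (λ g → ⌊ head g ≟F a ⌋ ∧ P (tail g)) ⟩
  ∑[ x < r ] count (λ g → ⌊ x ≟F a ⌋ ∧ P g) (allFuns m r)
    ≡⟨ sum-cong-≗ (λ x → count-const-∧ ⌊ x ≟F a ⌋ P (allFuns m r)) ⟩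
  ∑[ x < r ] (iverson ⌊ x ≟F a ⌋ * count P (allFuns m r))
    ≡⟨ ∑-single _ a (λ x x≢a → cong (λ b → iverson b * count P (allFuns m r)) (⌊⌋-false (x ≟F a) x≢a)) ⟩
  iverson ⌊ a ≟F a ⌋ * count P (allFuns m r)
    ≡⟨ cong (λ b → iverson b * count P (allFuns m r)) (Equivalence.from (⌊⌋-true⇔ (a ≟F a)) refl) ⟩
  count P (allFuns m r) + 0
    ≡⟨ +-identityʳ _ ⟩
  count P (allFuns m r) ∎
  where open ≡-Reasoning

agreeᵇ : {m r : ℕ} → Vector (Fin r) m → Vector (Fin r) m → Bool
agreeᵇ {zero}  c h = true
agreeᵇ {suc m} c h = ⌊ head h ≟F head c ⌋ ∧ agreeᵇ (tail c) (tail h)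

agreeᵇ⇔ : {m r : ℕ} (c h : Vector (Fin r) m) → agreeᵇ c h ≡ true ⇔ h ≗ c
agreeᵇ⇔ {zero}  c h = mk⇔ (λ _ ()) (λ _ → refl)
agreeᵇ⇔ {suc m} c h = mk⇔
  (λ agree → let h₀≡c₀ , rest = Equivalence.to ∧-≡true⇔ agree in λ where
     zero    → Equivalence.to (⌊⌋-true⇔ (head h ≟F head c)) h₀≡c₀
     (suc i) → Equivalence.to (agreeᵇ⇔ (tail c) (tail h)) rest i)
  (λ h≗c → Equivalence.from ∧-≡true⇔
     (Equivalence.from (⌊⌋-true⇔ (head h ≟F head c)) (h≗c zero) , Equivalence.from (agreeᵇ⇔ (tail c) (tail h)) (h≗c ∘ suc)))

count-agreeᵇ : {m r : ℕ} (c : Vector (Fin r) m) → count (agreeᵇ c) (allFuns m r) ≡ 1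
count-agreeᵇ {zero}  c = refl
count-agreeᵇ {suc m} c = trans (count-allFuns-pinned-head (head c) (agreeᵇ (tail c))) (count-agreeᵇ (tail c))

count-allFuns-split : {m₁ m₂ r : ℕ} (A : Vector (Fin r) m₁ → Bool) (B : Vector (Fin r) m₂ → Bool) →
  (∀ {f g} → f ≗ g → A f ≡ A g) →
  count (λ h → A (take m₁ h) ∧ B (drop m₁ h)) (allFuns (m₁ + m₂) r) ≡ count A (allFuns m₁ r) * count B (allFuns m₂ r)
count-allFuns-split {zero} {m₂} {r} A B A-cong = begin
  count (λ h → A (take 0 h) ∧ B h) (allFuns m₂ r)   ≡⟨ count-cong (λ h → cong (_∧ B h) (A-cong λ ())) (allFuns m₂ r) ⟩
  count (λ h → A []ᵥ ∧ B h) (allFuns m₂ r)          ≡⟨ count-const-∧ (A []ᵥ) B (allFuns m₂ r) ⟩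
  iverson (A []ᵥ) * count B (allFuns m₂ r)          ≡⟨ cong (_* count B (allFuns m₂ r)) (trans (count-∷ A []ᵥ []) (+-identityʳ _)) ⟨
  count A (allFuns 0 r) * count B (allFuns m₂ r)    ∎
  where open ≡-Reasoning
count-allFuns-split {suc m} {m₂} {r} A B A-cong = begin
  count (λ h → A (take (suc m) h) ∧ B (drop (suc m) h)) (allFuns (suc (m + m₂)) r)
    ≡⟨ count-allFuns-suc (λ h → A (take (suc m) h) ∧ B (drop (suc m) h)) ⟩
  ∑[ x < r ] count (λ g → A (take (suc m) (x ∷ᵥ g)) ∧ B (drop m g)) (allFuns (m + m₂) r)
    ≡⟨ sum-cong-≗ (λ x → count-cong (λ g → cong (_∧ B (drop m g)) (A-cong (take-∷ x g))) (allFuns (m + m₂) r)) ⟩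
  ∑[ x < r ] count (λ g → A (x ∷ᵥ take m g) ∧ B (drop m g)) (allFuns (m + m₂) r)
    ≡⟨ sum-cong-≗ (λ x → count-allFuns-split (λ f → A (x ∷ᵥ f)) B (λ f≗g → A-cong (∷-cong x f≗g))) ⟩
  ∑[ x < r ] (count (λ f → A (x ∷ᵥ f)) (allFuns m r) * count B (allFuns m₂ r))
    ≡⟨ *-distribʳ-sum (count B (allFuns m₂ r)) (λ x → count (λ f → A (x ∷ᵥ f)) (allFuns m r)) ⟨
  (∑[ x < r ] count (λ f → A (x ∷ᵥ f)) (allFuns m r)) * count B (allFuns m₂ r)
    ≡⟨ cong (_* count B (allFuns m₂ r)) (count-allFuns-suc {m} A) ⟨
  count A (allFuns (suc m) r) * count B (allFuns m₂ r) ∎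
  where
  open ≡-Reasoning
  take-∷ : (x : Fin r) (g : Vector (Fin r) (m + m₂)) → take (suc m) (x ∷ᵥ g) ≗ x ∷ᵥ take m g
  take-∷ x g zero    = refl
  take-∷ x g (suc i) = refl
  ∷-cong : (x : Fin r) {f g : Vector (Fin r) m} → f ≗ g → x ∷ᵥ f ≗ x ∷ᵥ g
  ∷-cong x f≗g zero    = refl
  ∷-cong x f≗g (suc i) = f≗g i

%-congˡ-+ : (p : ℕ) .{{_ : NonZero p}} {a b : ℕ} (c : ℕ) → a % p ≡ b % p → (a + c) % p ≡ (b + c) % p
%-congˡ-+ p {a} {b} c a≡b = begin
  (a + c) % p                 ≡⟨ %-distribˡ-+ a c p ⟩
  (a % p + c % p) % p         ≡⟨ cong (λ x → (x + c % p) % p) a≡b ⟩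
  (b % p + c % p) % p         ≡⟨ %-distribˡ-+ b c p ⟨
  (b + c) % p                 ∎
  where open ≡-Reasoning

suc-cancel-% : (p : ℕ) .{{_ : NonZero p}} {a b : ℕ} → suc a % p ≡ suc b % p → a % p ≡ b % p
suc-cancel-% p@(suc q) {a} {b} 1+a≡1+b = begin
  a % p            ≡⟨ [m+n]%n≡m%n a p ⟨
  (a + suc q) % p  ≡⟨ cong (_% p) (+-suc a q) ⟩
  (suc a + q) % p  ≡⟨ %-congˡ-+ p {suc a} {suc b} q 1+a≡1+b ⟩
  (suc b + q) % p  ≡⟨ cong (_% p) (+-suc b q) ⟨
  (b + suc q) % p  ≡⟨ [m+n]%n≡m%n b p ⟩
  b % p            ∎
  where open ≡-Reasoning

≡1-mod-step : (p : ℕ) .{{_ : NonZero p}} {x y d : ℕ} → x + 1 ≡ y + d → y % p ≡ 1 % p → d % p ≡ 1 % p → x % p ≡ 1 % p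
≡1-mod-step p {x} {y} {d} x+1≡y+d y≡1 d≡1 = suc-cancel-% p (begin
  suc x % p                ≡⟨ cong (_% p) (+-comm 1 x) ⟩
  (x + 1) % p              ≡⟨ cong (_% p) x+1≡y+d ⟩
  (y + d) % p              ≡⟨ %-distribˡ-+ y d p ⟩
  (y % p + d % p) % p      ≡⟨ cong₂ (λ u v → (u + v) % p) y≡1 d≡1 ⟩
  (1 % p + 1 % p) % p      ≡⟨ %-distribˡ-+ 1 1 p ⟨
  2 % p                    ∎)
  where open ≡-Reasoning

IsHom : (G H : Graph) → (Fin (n G) → Fin (n H)) → Set
IsHom G H f = ∀ x y → adj G x y ≡ true → adj H (f x) (f y) ≡ true

isHomᵇ⇔IsHom : (G H : Graph) (f : Fin (n G) → Fin (n H)) → isHomᵇ G H f ≡ true ⇔ IsHom G H f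
isHomᵇ⇔IsHom G H f = mk⇔
  (λ hom x y → Equivalence.to not-∨-≡true⇔ (Equivalence.to (allᵇ-tabulate⇔ _ (λ y → y)) (Equivalence.to (allᵇ-tabulate⇔ _ (λ x → x)) hom x) y))
  (λ hom → Equivalence.from (allᵇ-tabulate⇔ _ (λ x → x)) λ x → Equivalence.from (allᵇ-tabulate⇔ _ (λ y → y)) λ y →
     Equivalence.from not-∨-≡true⇔ (hom x y))

Respects : (G H : Graph) → (Fin (n G) → Maybe (Fin (n H))) → (Fin (n G) → Fin (n H)) → Set
Respects G H τ f = ∀ x y → τ x ≡ just y → f x ≡ y

respectsᵇ⇔Respects : (G H : Graph) (τ : Fin (n G) → Maybe (Fin (n H))) (f : Fin (n G) → Fin (n H)) →
  respectsᵇ G H τ f ≡ true ⇔ Respects G H τ f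
respectsᵇ⇔Respects G H τ f = mk⇔ to from
  where
  to : respectsᵇ G H τ f ≡ true → Respects G H τ f
  to r x y τx≡y with τ x | Equivalence.to (allᵇ-tabulate⇔ _ (λ x → x)) r x
  ... | just y′ | fx≟y′ with refl ← τx≡y = Equivalence.to (⌊⌋-true⇔ (f x ≟F y)) fx≟y′
  -- The per-vertex test of respectsᵇ is local to its definition, so its type is left to unification.
  test-passes : Respects G H τ f → ∀ x → _
  from : Respects G H τ f → respectsᵇ G H τ f ≡ true
  from resp = Equivalence.from (allᵇ-tabulate⇔ _ (λ x → x)) (test-passes resp)
  test-passes resp x with τ x in τx≡y
  ... | nothing = refl
  ... | just y  = Equivalence.from (⌊⌋-true⇔ (f x ≟F y)) (resp x y τx≡y)

-- Combs in a graph

module Combs (H : Graph) where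

  V : Set
  V = Fin (n H)

  _~_ : V → V → Bool
  _~_ = adj H

  ~-flip : {x y : V} → x ~ y ≡ true → y ~ x ≡ true
  ~-flip {x} {y} x~y = trans (Graph.sym H y x) x~y

  ~-≢ : {x y : V} → x ~ y ≡ true → x ≢ y
  ~-≢ {x} x~y refl with () ← trans (sym x~y) (irrefl H x)

  ~-∧-~ : (x y : V) → (x ~ y ∧ y ~ x) ≡ x ~ y
  ~-∧-~ x y = trans (cong (x ~ y ∧_) (Graph.sym H y x)) (∧-idem (x ~ y))

  deg-∑ : (a : V) → deg H a ≡ ∑[ x < n H ] iverson (a ~ x)
  deg-∑ a = count-tabulate (a ~_) (λ x → x)

  codegree : V → V → ℕ
  codegree a b = ∑[ x < n H ] iverson (a ~ x ∧ x ~ b)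

  codegree-self : (a : V) → codegree a a ≡ deg H a
  codegree-self a = trans (sum-cong-≗ (λ x → cong iverson (~-∧-~ a x))) (sym (deg-∑ a))

  -- combᵇ a c b w tests that a, w₀, …, w_{m-1}, b is a walk with each wᵢ adjacent to cᵢ, i.e. that w maps
  -- the spine of a comb whose ends are pinned to a, b and whose teeth are pinned to c.
  combᵇ : {m : ℕ} → V → Vector V m → V → Vector V m → Bool
  combᵇ {zero}  a c b w = a ~ b
  combᵇ {suc m} a c b w = a ~ head w ∧ (head w ~ head c ∧ combᵇ (head w) (tail c) b (tail w))

  combs : {m : ℕ} → V → Vector V m → V → ℕ
  combs {m} a c b = count (combᵇ a c b) (allFuns m (n H))

  combs-zero : (a : V) (c : Vector V 0) (b : V) → combs a c b ≡ iverson (a ~ b)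
  combs-zero a c b = trans (count-∷ (combᵇ a c b) []ᵥ []) (+-identityʳ _)

  combs-suc : {m : ℕ} (a : V) (c : Vector V (suc m)) (b : V) →
    combs a c b ≡ ∑[ x < n H ] (iverson (a ~ x ∧ x ~ head c) * combs x (tail c) b)
  combs-suc {m} a c b = trans (count-allFuns-suc (combᵇ a c b)) (sum-cong-≗ λ x →
    trans (count-cong (λ g → sym (∧-assoc (a ~ x) (x ~ head c) _)) (allFuns m (n H)))
          (count-const-∧ (a ~ x ∧ x ~ head c) (combᵇ x (tail c) b) (allFuns m (n H))))

  combs-single-tooth : (c : Vector V 1) (b : V) → combs (head c) c b ≡ codegree (head c) b
  combs-single-tooth c b = trans (combs-suc (head c) c b) (sum-cong-≗ λ x →
    trans (cong₂ (λ β m → iverson β * m) (~-∧-~ (head c) x) (combs-zero x (tail c) b)) (iverson-∧ (head c ~ x) (x ~ b)))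

  IsWalk : {m : ℕ} → Vector V m → Set
  IsWalk c = ∀ i j → suc (toℕ i) ≡ toℕ j → c i ~ c j ≡ true

  IsWalk-tail : {m : ℕ} (c : Vector V (suc m)) → IsWalk c → IsWalk (tail c)
  IsWalk-tail c walk i j i+1≡j = walk (suc i) (suc j) (cong suc i+1≡j)

  Injective-tail : {m : ℕ} (c : Vector V (suc m)) → Injective _≡_ _≡_ c → Injective _≡_ _≡_ (tail c)
  Injective-tail c inj eq = suc-injectiveF (inj eq)

  IsWalk-last : {m : ℕ} (c : Vector V (suc (suc m))) → IsWalk c → last (init c) ~ last c ≡ true
  IsWalk-last {zero}  c walk = walk zero (suc zero) refl
  IsWalk-last {suc m} c walk = IsWalk-last (tail c) (IsWalk-tail c walk)

  record IsComb {m : ℕ} (a : V) (c : Vector V m) (b : V) (w : Vector V m) : Set where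
    field
      teeth : ∀ i → w i ~ c i ≡ true
      spine : IsWalk w
      start : ∀ i → toℕ i ≡ 0 → a ~ w i ≡ true
      end   : ∀ i → suc (toℕ i) ≡ m → w i ~ b ≡ true

  IsComb-single⇔ : {a b : V} {c w : Vector V 1} →
    IsComb a c b w ⇔ (a ~ head w ≡ true × head w ~ head c ≡ true × head w ~ b ≡ true)
  IsComb-single⇔ = mk⇔
    (λ comb → let open IsComb comb in start zero refl , teeth zero , end zero refl)
    (λ (a~w₀ , w₀~c₀ , w₀~b) → record
      { teeth = λ { zero → w₀~c₀ }
      ; spine = λ { zero zero () }
      ; start = λ { zero _ → a~w₀ }
      ; end   = λ { zero _ → w₀~b }
      })

  IsComb-∷⇔ : {m : ℕ} {a b : V} {c w : Vector V (suc (suc m))} →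
    IsComb a c b w ⇔ (a ~ head w ≡ true × head w ~ head c ≡ true × IsComb (head w) (tail c) b (tail w))
  IsComb-∷⇔ {m} {a} {b} {c} {w} = mk⇔ to from
    where
    to : IsComb a c b w → a ~ head w ≡ true × head w ~ head c ≡ true × IsComb (head w) (tail c) b (tail w)
    to comb = start zero refl , teeth zero , record
      { teeth = teeth ∘ suc
      ; spine = IsWalk-tail w spine
      ; start = λ i i≡0 → spine zero (suc i) (cong suc (sym i≡0))
      ; end   = λ i 1+i≡m → end (suc i) (cong suc 1+i≡m)
      }
      where open IsComb comb
    from : a ~ head w ≡ true × head w ~ head c ≡ true × IsComb (head w) (tail c) b (tail w) → IsComb a c b w
    from (a~w₀ , w₀~c₀ , comb) = record
      { teeth = λ { zero → w₀~c₀ ; (suc i) → teeth i }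
      ; spine = λ { zero (suc j) 1≡1+j → start j (sym (suc-injective 1≡1+j))
                  ; (suc i) (suc j) 2+i≡1+j → spine i j (suc-injective 2+i≡1+j)
                  ; zero zero () ; (suc i) zero () }
      ; start = λ { zero _ → a~w₀ ; (suc i) () }
      ; end   = λ { zero () ; (suc i) 2+i≡2+m → end i (suc-injective 2+i≡2+m) }
      }
      where open IsComb comb

  combᵇ⇔IsComb : {m : ℕ} (a : V) (c : Vector V (suc m)) (b : V) (w : Vector V (suc m)) →
    combᵇ a c b w ≡ true ⇔ IsComb a c b w
  combᵇ⇔IsComb {zero}  a c b w = ⇔-trans ∧-≡true⇔ (⇔-trans (⇔-refl ×-⇔ ∧-≡true⇔) (⇔-sym IsComb-single⇔))
  combᵇ⇔IsComb {suc m} a c b w = ⇔-trans ∧-≡true⇔ (⇔-trans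
    (⇔-refl ×-⇔ ⇔-trans ∧-≡true⇔ (⇔-refl ×-⇔ combᵇ⇔IsComb (head w) (tail c) b (tail w))) (⇔-sym IsComb-∷⇔))

  IsComb-subst : {m : ℕ} {a a′ b b′ : V} {c c′ w : Vector V m} →
    a ≡ a′ → c ≗ c′ → b ≡ b′ → IsComb a c b w → IsComb a′ c′ b′ w
  IsComb-subst {w = w} refl c≗c′ refl comb = record
    { teeth = λ i → subst (λ z → w i ~ z ≡ true) (c≗c′ i) (teeth i)
    ; spine = spine
    ; start = start
    ; end   = end
    }
    where open IsComb comb

  combᵇ-cong : {m : ℕ} (a : V) (c : Vector V m) (b : V) {w w′ : Vector V m} → w ≗ w′ → combᵇ a c b w ≡ combᵇ a c b w′
  combᵇ-cong {zero}  a c b w≗w′ = refl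
  combᵇ-cong {suc m} a c b {w} {w′} w≗w′ = cong₂ (λ x r → a ~ x ∧ (x ~ head c ∧ r)) (w≗w′ zero)
    (trans (combᵇ-cong (head w) (tail c) b (w≗w′ ∘ suc)) (cong (λ x → combᵇ x (tail c) b (tail w′)) (w≗w′ zero)))

  module _ (square-free : SquareFree H) where

    common-neighbour-unique : {a b x y : V} → a ≢ b →
      a ~ x ≡ true → x ~ b ≡ true → a ~ y ≡ true → y ~ b ≡ true → x ≡ y
    common-neighbour-unique {a} {b} {x} {y} a≢b a~x x~b a~y y~b with x ≟F y
    ... | yes x≡y = x≡y
    ... | no  x≢y = ⊥-elim (square-free a x b y (~-≢ a~x) a≢b (~-≢ a~y) (~-≢ x~b) x≢y (~-≢ (~-flip y~b))
                                         a~x x~b (~-flip y~b) (~-flip a~y))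

    codegree-≡1 : {a b x : V} → a ≢ b → a ~ x ≡ true → x ~ b ≡ true → codegree a b ≡ 1
    codegree-≡1 {a} {b} {x} a≢b a~x x~b = begin
      codegree a b              ≡⟨ ∑-single _ x (λ y y≢x → cong iverson (∧-≡false λ a~y y~b →
                                     y≢x (common-neighbour-unique a≢b a~y y~b a~x x~b))) ⟩
      iverson (a ~ x ∧ x ~ b)   ≡⟨ cong₂ (λ β δ → iverson (β ∧ δ)) a~x x~b ⟩
      1                         ∎
      where open ≡-Reasoning

    -- D₀ is the only common neighbour of a and D₁, so the walk trails D one step behind.
    combs-forced : {m : ℕ} (D : Vector V (suc (suc m))) → IsWalk D → Injective _≡_ _≡_ D → (a b : V) →
      a ~ head D ≡ true → a ≢ D (suc zero) → combs a (tail D) b ≡ iverson (last (init D) ~ b)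
    combs-forced {m} D walk inj a b a~D₀ a≢D₁ = begin
      combs a (tail D) b
        ≡⟨ combs-suc a (tail D) b ⟩
      ∑[ x < n H ] (iverson (a ~ x ∧ x ~ D (suc zero)) * combs x (tail (tail D)) b)
        ≡⟨ ∑-single _ (head D) off-D₀ ⟩
      iverson (a ~ head D ∧ head D ~ D (suc zero)) * combs (head D) (tail (tail D)) b
        ≡⟨ cong₂ (λ β δ → iverson (β ∧ δ) * combs (head D) (tail (tail D)) b) a~D₀ D₀~D₁ ⟩
      combs (head D) (tail (tail D)) b + 0
        ≡⟨ +-identityʳ _ ⟩
      combs (head D) (tail (tail D)) b
        ≡⟨ from-D₀ m D walk inj ⟩
      iverson (last (init D) ~ b) ∎
      where
      open ≡-Reasoning
      D₀~D₁ : head D ~ D (suc zero) ≡ true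
      D₀~D₁ = walk zero (suc zero) refl
      off-D₀ : ∀ x → x ≢ head D → iverson (a ~ x ∧ x ~ D (suc zero)) * combs x (tail (tail D)) b ≡ 0
      off-D₀ x x≢D₀ = cong (λ β → iverson β * combs x (tail (tail D)) b) (∧-≡false λ a~x x~D₁ →
        x≢D₀ (common-neighbour-unique a≢D₁ a~x x~D₁ a~D₀ D₀~D₁))
      from-D₀ : (m : ℕ) (D : Vector V (suc (suc m))) → IsWalk D → Injective _≡_ _≡_ D →
        combs (head D) (tail (tail D)) b ≡ iverson (last (init D) ~ b)
      from-D₀ zero    D walk inj = combs-zero (head D) (tail (tail D)) b
      from-D₀ (suc m) D walk inj = combs-forced (tail D) (IsWalk-tail D walk) (Injective-tail D inj) (head D) b
        (walk zero (suc zero) refl) (λ D₀≡D₂ → contradiction (inj D₀≡D₂) λ ())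

    -- The first vertex of the walk is a neighbour x of D₀: x = D₁ leaves the comb along tail D, and each of
    -- the other deg D₀ - 1 choices is forced by combs-forced; both sides are shifted to avoid subtraction.
    combs-step : {m : ℕ} (D : Vector V (suc (suc m))) → IsWalk D → Injective _≡_ _≡_ D → (b : V) →
      combs (head D) D b + iverson (last (init D) ~ b)
        ≡ combs (D (suc zero)) (tail D) b + deg H (head D) * iverson (last (init D) ~ b)
    combs-step D walk inj b = begin
      combs (head D) D b + κ
        ≡⟨ cong (_+ κ) (combs-suc (head D) D b) ⟩
      ∑[ x < n H ] (iverson (head D ~ x ∧ x ~ head D) * combs x (tail D) b) + κ
        ≡⟨ cong (_+ κ) (sum-cong-≗ λ x → cong (λ β → iverson β * combs x (tail D) b) (~-∧-~ (head D) x)) ⟩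
      ∑[ x < n H ] (iverson (head D ~ x) * combs x (tail D) b) + κ
        ≡⟨ ∑-except-one (head D ~_) (λ x → combs x (tail D) b) κ (D (suc zero)) (walk zero (suc zero) refl)
             (λ x x≢D₁ D₀~x → combs-forced D walk inj x b (~-flip D₀~x) x≢D₁) ⟩
      combs (D (suc zero)) (tail D) b + ∑[ x < n H ] iverson (head D ~ x) * κ
        ≡⟨ cong (λ d → combs (D (suc zero)) (tail D) b + d * κ) (deg-∑ (head D)) ⟨
      combs (D (suc zero)) (tail D) b + deg H (head D) * κ ∎
      where
      open ≡-Reasoning
      κ : ℕ
      κ = iverson (last (init D) ~ b)

    combs-drop-first-tooth : {m : ℕ} (c : Vector V (suc (suc m))) → IsWalk c → Injective _≡_ _≡_ c → (b : V) →
      last (init c) ~ b ≡ false → combs (head c) c b ≡ combs (c (suc zero)) (tail c) b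
    combs-drop-first-tooth c walk inj b penultimate≁b = begin
      combs (head c) c b                                   ≡⟨ +-identityʳ _ ⟨
      combs (head c) c b + iverson false                   ≡⟨ cong (λ β → combs (head c) c b + iverson β) penultimate≁b ⟨
      combs (head c) c b + iverson (last (init c) ~ b)     ≡⟨ combs-step c walk inj b ⟩
      combs c₁ (tail c) b + deg H (head c) * iverson (last (init c) ~ b)
                                                           ≡⟨ cong (λ β → combs c₁ (tail c) b + deg H (head c) * iverson β) penultimate≁b ⟩
      combs c₁ (tail c) b + deg H (head c) * 0             ≡⟨ cong (combs c₁ (tail c) b +_) (*-zeroʳ (deg H (head c))) ⟩
      combs c₁ (tail c) b + 0                              ≡⟨ +-identityʳ _ ⟩
      combs c₁ (tail c) b                                  ∎
      where
      open ≡-Reasoning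
      c₁ : V
      c₁ = c (suc zero)

    combs-≡-codegree : {m : ℕ} (c : Vector V (suc (suc m))) → IsWalk c → Injective _≡_ _≡_ c → (b : V) →
      last (init c) ~ b ≡ false → combs (head c) c b ≡ codegree (last c) b
    combs-≡-codegree {zero}  c walk inj b penultimate≁b =
      trans (combs-drop-first-tooth c walk inj b penultimate≁b) (combs-single-tooth (tail c) b)
    combs-≡-codegree {suc m} c walk inj b penultimate≁b =
      trans (combs-drop-first-tooth c walk inj b penultimate≁b)
            (combs-≡-codegree (tail c) (IsWalk-tail c walk) (Injective-tail c inj) b penultimate≁b)

    combs-head-last-% : (p : ℕ) .{{_ : NonZero p}} → (∀ x → deg H x % p ≡ 1 % p) →
      {m : ℕ} (c : Vector V (suc m)) → IsWalk c → Injective _≡_ _≡_ c → combs (head c) c (last c) % p ≡ 1 % p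
    combs-head-last-% p deg≡1 {zero}  c walk inj =
      trans (cong (_% p) (trans (combs-single-tooth c (head c)) (codegree-self (head c)))) (deg≡1 (head c))
    combs-head-last-% p deg≡1 {suc m} c walk inj =
      ≡1-mod-step p step (combs-head-last-% p deg≡1 (tail c) (IsWalk-tail c walk) (Injective-tail c inj)) (deg≡1 (head c))
      where
      step : combs (head c) c (last c) + 1 ≡ combs (c (suc zero)) (tail c) (last c) + deg H (head c)
      step = begin
        combs (head c) c (last c) + 1
          ≡⟨ cong (λ β → combs (head c) c (last c) + iverson β) (IsWalk-last c walk) ⟨
        combs (head c) c (last c) + iverson (last (init c) ~ last c)
          ≡⟨ combs-step c walk inj (last c) ⟩
        combs (c (suc zero)) (tail c) (last c) + deg H (head c) * iverson (last (init c) ~ last c)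
          ≡⟨ cong (λ β → combs (c (suc zero)) (tail c) (last c) + deg H (head c) * iverson β) (IsWalk-last c walk) ⟩
        combs (c (suc zero)) (tail c) (last c) + deg H (head c) * 1
          ≡⟨ cong (combs (c (suc zero)) (tail c) (last c) +_) (*-identityʳ (deg H (head c))) ⟩
        combs (c (suc zero)) (tail c) (last c) + deg H (head c) ∎
        where open ≡-Reasoning

    module _ {m : ℕ} {θ : V} {γ : Vector V (suc (suc m))} (cycle : IsCycle H (suc (suc m)) θ γ) where

      private
        γ-injective : Injective _≡_ _≡_ γ
        γ-injective = proj₁ cycle _ _
        θ∉γ : ∀ i → θ ≢ γ i
        θ∉γ = proj₁ (proj₂ cycle)
        γ-walk : IsWalk γ
        γ-walk = proj₁ (proj₂ (proj₂ (proj₂ cycle)))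
        θ~head : θ ~ head γ ≡ true
        θ~head = proj₁ (proj₂ (proj₂ cycle)) zero refl
        last~θ : last γ ~ θ ≡ true
        last~θ = proj₂ (proj₂ (proj₂ (proj₂ cycle))) (fromℕ (suc m)) (cong suc (toℕ-fromℕ (suc m)))
        last≢head : last γ ≢ head γ
        last≢head last≡head = contradiction (γ-injective last≡head) λ ()

        θγ-walk : IsWalk (θ ∷ᵥ γ)
        θγ-walk zero    (suc zero)    _    = θ~head
        θγ-walk (suc i) (suc j)       1+i≡j = γ-walk i j (suc-injective 1+i≡j)
        θγ-walk zero    zero          ()
        θγ-walk zero    (suc (suc j)) ()
        θγ-walk (suc i) zero          ()

        θγ-injective : Injective _≡_ _≡_ (θ ∷ᵥ γ)
        θγ-injective {zero}  {zero}  _   = refl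
        θγ-injective {zero}  {suc j} θ≡γⱼ = contradiction θ≡γⱼ (θ∉γ j)
        θγ-injective {suc i} {zero}  γᵢ≡θ = contradiction (sym γᵢ≡θ) (θ∉γ i)
        θγ-injective {suc i} {suc j} γᵢ≡γⱼ = cong suc (γ-injective γᵢ≡γⱼ)

      -- Since last γ ~ θ ~ head γ, a walk from last γ trails the path θ ∷ γ one step behind.
      cycle-combs-from-last : (b : V) → combs (last γ) γ b ≡ iverson (last (init γ) ~ b)
      cycle-combs-from-last b = combs-forced (θ ∷ᵥ γ) θγ-walk θγ-injective (last γ) b last~θ last≢head

      cycle-penultimate≁head : last (init γ) ~ head γ ≡ false
      cycle-penultimate≁head with last (init γ) ~ head γ in penultimate~head
      ... | false = refl
      ... | true  = contradiction (sym penultimate≡θ) (θ∉γ _)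
        where
        penultimate≡θ : last (init γ) ≡ θ
        penultimate≡θ = common-neighbour-unique last≢head (~-flip (IsWalk-last γ γ-walk)) penultimate~head last~θ θ~head

      cycle-codegree-last-head : codegree (last γ) (head γ) ≡ 1
      cycle-codegree-last-head = codegree-≡1 last≢head last~θ θ~head

      cycle-combs-last-head : combs (last γ) γ (head γ) ≡ 0
      cycle-combs-last-head = trans (cycle-combs-from-last (head γ)) (cong iverson cycle-penultimate≁head)

      cycle-combs-head-head : combs (head γ) γ (head γ) ≡ 1
      cycle-combs-head-head =
        trans (combs-≡-codegree γ γ-walk γ-injective (head γ) cycle-penultimate≁head) cycle-codegree-last-head

      cycle-combs-last-last : combs (last γ) γ (last γ) ≡ 1
      cycle-combs-last-last = trans (cycle-combs-from-last (last γ)) (cong iverson (IsWalk-last γ γ-walk))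

      cycle-combs-head-last-% : (p : ℕ) .{{_ : NonZero p}} → (∀ x → deg H x % p ≡ 1 % p) →
        combs (head γ) γ (last γ) % p ≡ 1 % p
      cycle-combs-head-last-% p deg≡1 = combs-head-last-% p deg≡1 γ γ-walk γ-injective

-- The gadget K

kenc : (k : ℕ) → KV k → Fin (2 + (k + k))
kenc k s     = sK k
kenc k t     = tK k
kenc k (v i) = vK k i
kenc k (u i) = uK k i

kdecode-kenc : (k : ℕ) (x : KV k) → kdecode k (kenc k x) ≡ x
kdecode-kenc k s = refl
kdecode-kenc k t = refl
kdecode-kenc k (v i) rewrite splitAt-↑ˡ k i k = refl
kdecode-kenc k (u i) rewrite splitAt-↑ʳ k k i = refl

kenc-kdecode : (k : ℕ) (x : Fin (2 + (k + k))) → kenc k (kdecode k x) ≡ x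
kenc-kdecode k zero          = refl
kenc-kdecode k (suc zero)    = refl
kenc-kdecode k (suc (suc x)) with splitAt k x in eq
... | inj₁ i = cong (λ y → suc (suc y)) (splitAt⁻¹-↑ˡ eq)
... | inj₂ i = cong (λ y → suc (suc y)) (splitAt⁻¹-↑ʳ eq)

module _ (H : Graph) where

  open Combs H

  IsHom-K⇔ : (k : ℕ) (f : Fin (2 + (k + k)) → V) →
    IsHom (K k) H f ⇔ (∀ x y → kEdge₀ k x y ≡ true → f (kenc k x) ~ f (kenc k y) ≡ true)
  IsHom-K⇔ k f = mk⇔ to from
    where
    to : IsHom (K k) H f → ∀ x y → kEdge₀ k x y ≡ true → f (kenc k x) ~ f (kenc k y) ≡ true
    to hom x y xy = hom (kenc k x) (kenc k y)
      (subst₂ (λ x′ y′ → kEdge₀ k x′ y′ ∨ kEdge₀ k y′ x′ ≡ true) (sym (kdecode-kenc k x)) (sym (kdecode-kenc k y))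
              (cong (_∨ kEdge₀ k y x) xy))
    from : (∀ x y → kEdge₀ k x y ≡ true → f (kenc k x) ~ f (kenc k y) ≡ true) → IsHom (K k) H f
    from edges x y xy with kEdge₀ k (kdecode k x) (kdecode k y) in x′y′ | kEdge₀ k (kdecode k y) (kdecode k x) in y′x′
    ... | true  | _    = subst₂ (λ x″ y″ → f x″ ~ f y″ ≡ true) (kenc-kdecode k x) (kenc-kdecode k y) (edges _ _ x′y′)
    ... | false | true = ~-flip (subst₂ (λ y″ x″ → f y″ ~ f x″ ≡ true) (kenc-kdecode k y) (kenc-kdecode k x) (edges _ _ y′x′))

  kEdges⇔IsComb : (k : ℕ) (F : KV k → V) →
    (∀ x y → kEdge₀ k x y ≡ true → F x ~ F y ≡ true) ⇔ IsComb (F s) (F ∘ u) (F t) (F ∘ v)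
  kEdges⇔IsComb k F = mk⇔ to from
    where
    to : (∀ x y → kEdge₀ k x y ≡ true → F x ~ F y ≡ true) → IsComb (F s) (F ∘ u) (F t) (F ∘ v)
    to edges = record
      { teeth = λ i → edges (v i) (u i) (Equivalence.from (⌊⌋-true⇔ (i ≟F i)) refl)
      ; spine = λ i j 1+i≡j → edges (v i) (v j) (Equivalence.from (⌊⌋-true⇔ (suc (toℕ i) ≟ toℕ j)) 1+i≡j)
      ; start = λ i i≡0 → edges s (v i) (Equivalence.from (⌊⌋-true⇔ (toℕ i ≟ 0)) i≡0)
      ; end   = λ i 1+i≡k → edges (v i) t (Equivalence.from (⌊⌋-true⇔ (suc (toℕ i) ≟ k)) 1+i≡k)
      }
    from : IsComb (F s) (F ∘ u) (F t) (F ∘ v) → ∀ x y → kEdge₀ k x y ≡ true → F x ~ F y ≡ true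
    from comb (v i) (v j) e = spine i j (Equivalence.to (⌊⌋-true⇔ (suc (toℕ i) ≟ toℕ j)) e)
      where open IsComb comb
    from comb (v i) (u j) e with refl ← Equivalence.to (⌊⌋-true⇔ (i ≟F j)) e = IsComb.teeth comb i
    from comb s     (v j) e = IsComb.start comb j (Equivalence.to (⌊⌋-true⇔ (toℕ j ≟ 0)) e)
    from comb (v i) t     e = IsComb.end comb i (Equivalence.to (⌊⌋-true⇔ (suc (toℕ i) ≟ k)) e)
    from comb s     s     ()
    from comb s     t     ()
    from comb s     (u j) ()
    from comb t     y     ()
    from comb (v i) s     ()
    from comb (u i) y     ()

  Respects-kPin⇔ : (k : ℕ) (γ : Vector V k) (f : Fin (2 + (k + k)) → V) →
    Respects (K k) H (kPin k H γ) f ⇔ (∀ i → f (uK k i) ≡ γ i)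
  Respects-kPin⇔ k γ f = mk⇔ to from
    where
    kPin-uK : ∀ i → kPin k H γ (uK k i) ≡ just (γ i)
    kPin-uK i with kdecode k (uK k i) | kdecode-kenc k (u i)
    ... | .(u i) | refl = refl
    to : Respects (K k) H (kPin k H γ) f → ∀ i → f (uK k i) ≡ γ i
    to resp i = resp (uK k i) (γ i) (kPin-uK i)
    from : (∀ i → f (uK k i) ≡ γ i) → Respects (K k) H (kPin k H γ) f
    from pins x y τx≡y with kdecode k x in x≡uᵢ | τx≡y
    ... | u i | refl = trans (cong f (trans (sym (kenc-kdecode k x)) (cong (kenc k) x≡uᵢ))) (pins i)

  module _ {m : ℕ} (γ : Vector V (suc m)) (a b : V) where

    private
      k : ℕ
      k = suc m

    IsPinnedHom : (Fin (2 + (k + k)) → V) → Set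
    IsPinnedHom f = f (sK k) ≡ a × f (tK k) ≡ b × IsComb a γ b (f ∘ vK k) × (∀ i → f (uK k i) ≡ γ i)

    homᵇ⇔IsPinnedHom : (f : Fin (2 + (k + k)) → V) →
      (isHomᵇ (K k) H f ∧ respectsᵇ (K k) H (kPin k H γ) f ∧ ⌊ f (sK k) ≟F a ⌋ ∧ ⌊ f (tK k) ≟F b ⌋) ≡ true
        ⇔ IsPinnedHom f
    homᵇ⇔IsPinnedHom f =
      ⇔-trans (⇔-trans ∧-≡true⇔ (isHomᵇ⇔IsHom (K k) H f ×-⇔ ⇔-trans ∧-≡true⇔
                 (respectsᵇ⇔Respects (K k) H (kPin k H γ) f ×-⇔ ⇔-trans ∧-≡true⇔ (⌊⌋-true⇔ (f (sK k) ≟F a) ×-⇔ ⌊⌋-true⇔ (f (tK k) ≟F b)))))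
      (⇔-trans (⇔-trans (IsHom-K⇔ k f) (kEdges⇔IsComb k (f ∘ kenc k)) ×-⇔ (Respects-kPin⇔ k γ f ×-⇔ ⇔-refl))
      (mk⇔ (λ (comb , pins , fs≡a , ft≡b) → fs≡a , ft≡b , IsComb-subst fs≡a pins ft≡b comb , pins)
           (λ (fs≡a , ft≡b , comb , pins) → IsComb-subst (sym fs≡a) (sym ∘ pins) (sym ft≡b) comb , pins , fs≡a , ft≡b)))

    factorᵇ : (Fin (2 + (k + k)) → V) → Bool
    factorᵇ f = ⌊ f (sK k) ≟F a ⌋ ∧ (⌊ f (tK k) ≟F b ⌋ ∧ (combᵇ a γ b (f ∘ vK k) ∧ agreeᵇ γ (f ∘ uK k)))

    factorᵇ⇔IsPinnedHom : (f : Fin (2 + (k + k)) → V) → factorᵇ f ≡ true ⇔ IsPinnedHom f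
    factorᵇ⇔IsPinnedHom f = ⇔-trans ∧-≡true⇔ (⌊⌋-true⇔ (f (sK k) ≟F a) ×-⇔ ⇔-trans ∧-≡true⇔ (⌊⌋-true⇔ (f (tK k) ≟F b) ×-⇔
      ⇔-trans ∧-≡true⇔ (combᵇ⇔IsComb a γ b (f ∘ vK k) ×-⇔ agreeᵇ⇔ γ (f ∘ uK k))))

    homCount-K≡combs : homCount (K k) H (kPin k H γ) (sK k) (tK k) a b ≡ combs a γ b
    homCount-K≡combs = begin
      homCount (K k) H (kPin k H γ) (sK k) (tK k) a b
        ≡⟨ count-cong (λ f → ⇔→≡ (⇔-trans (homᵇ⇔IsPinnedHom f) (⇔-sym (factorᵇ⇔IsPinnedHom f)))) (allFuns (2 + (k + k)) (n H)) ⟩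
      count factorᵇ (allFuns (2 + (k + k)) (n H))
        ≡⟨ count-allFuns-pinned-head a _ ⟩
      count (λ g → ⌊ head g ≟F b ⌋ ∧ (combᵇ a γ b (take k (tail g)) ∧ agreeᵇ γ (drop k (tail g)))) (allFuns (suc (k + k)) (n H))
        ≡⟨ count-allFuns-pinned-head b _ ⟩
      count (λ g → combᵇ a γ b (take k g) ∧ agreeᵇ γ (drop k g)) (allFuns (k + k) (n H))
        ≡⟨ count-allFuns-split (combᵇ a γ b) (agreeᵇ γ) (combᵇ-cong a γ b) ⟩
      combs a γ b * count (agreeᵇ γ) (allFuns k (n H))
        ≡⟨ cong (combs a γ b *_) (count-agreeᵇ γ) ⟩
      combs a γ b * 1
        ≡⟨ *-identityʳ (combs a γ b) ⟩
      combs a γ b ∎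
      where open ≡-Reasoning

lemma9 : (p : ℕ) .{{_ : NonZero p}} → Prime p →
    (H : Graph) → SquareFree H → (∀ x → deg H x % p ≡ 1 % p) →
    (k : ℕ) → 2 ≤ k →
    (θ : Fin (n H)) (γ : Fin k → Fin (n H)) → IsCycle H k θ γ →
    (i₁ iₖ : Fin k) → toℕ i₁ ≡ 0 → suc (toℕ iₖ) ≡ k →
    (ωs ωt : Fin (n H)) →
    (ωs ≡ γ i₁ ⊎ ωs ≡ γ iₖ) → ωs ≢ γ i₁ →
    (ωt ≡ γ i₁ ⊎ ωt ≡ γ iₖ) → ωt ≢ γ iₖ →
    (homCount (K k) H (kPin k H γ) (sK k) (tK k) ωs ωt ≡ 0)
    × (homCount (K k) H (kPin k H γ) (sK k) (tK k) (γ i₁) ωt % p ≡ 1 % p)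
    × (homCount (K k) H (kPin k H γ) (sK k) (tK k) ωs (γ iₖ) % p ≡ 1 % p)
    × (homCount (K k) H (kPin k H γ) (sK k) (tK k) (γ i₁) (γ iₖ) % p ≡ 1 % p)
lemma9 p _ H square-free deg≡1 .(suc (suc m)) (s≤s (s≤s {n = m} _)) θ γ cycle i₁ iₖ i₁≡0 1+iₖ≡k
       ωs ωt ωs∈Δ₁ ωs≢δ₁ ωt∈Δ₂ ωt≢δ₂
  rewrite ≡-other ωs∈Δ₁ ωs≢δ₁ | ≡-other (swap ωt∈Δ₂) ωt≢δ₂
        | index-head γ i₁≡0 | index-last γ (suc-injective 1+iₖ≡k)
  = trans (homCount-K≡combs H γ _ _) (cycle-combs-last-head square-free cycle)
  , cong (_% p) (trans (homCount-K≡combs H γ _ _) (cycle-combs-head-head square-free cycle))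
  , cong (_% p) (trans (homCount-K≡combs H γ _ _) (cycle-combs-last-last square-free cycle))
  , trans (cong (_% p) (homCount-K≡combs H γ _ _)) (cycle-combs-head-last-% square-free cycle p deg≡1)
  where open Combs H
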